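{- Let $n\ge1$. The bijection $2^{[n]}\to\{\text{even-cardinality subsets of }[n+1]\}$, $A\mapsto\overline{A}$, where $\overline{A}=A$ if $|A|$ is even and $\overline{A}=A\cup\{n+1\}$ if $|A|$ is odd, induces a linear (coordinate-relabelling) isomorphism $\mathbb{T}^{2^{[n]}}\to\mathbb{T}^{\{\text{even subsets of }[n+1]\}}$ which restricts to an isomorphism $\mathrm{Dr}(B_n,P_n)\cong\mathrm{Dr}(D_{n+1},P_{n+1})$.
   Context: $\mathbb{T}=\mathbb{R}\cup\{\infty\}$ with $\oplus=\min$, $\odot=+$; $\nu$ satisfies a tropical polynomial $f$ if the minimum of its monomials at $\nu$ is $\infty$ or attained at least twice; $I\triangle i=I\triangle\{i\}$. $\mathrm{Dr}(B_n,P_n)\subseteq\mathbb{T}^{2^{[n]}}$ is the set of points satisfying all $f^B_{I,J}$, $I,J\subseteq[n]$, $|I\triangle J|\ge3$, where $f^B_{I,J}=\bigoplus_{i\in I\triangle J}x_{I\triangle i}\odot x_{J\triangle i}$ if $|I\triangle J|$ is even and $x_I\odot x_J\oplus\bigoplus_{i\in I\triangle J}x_{I\triangle i}\odot x_{J\triangle i}$ if odd. $\mathrm{Dr}(D_{n+1},P_{n+1})\subseteq\mathbb{T}^{\{\text{even subsets of }[n+1]\}}$ is the set of points satisfying all $f^D_{I,J}=\bigoplus_{i\in I\triangle J}x_{I\triangle i}\odot x_{J\triangle i}$ for $I,J\subseteq[n+1]$ of odd cardinality with $|I\triangle J|\ge4$. -}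

module Defs where

open import Data.Bool using (Bool; true; false; not; _xor_)
open import Data.Nat using (ℕ; zero; suc)
open import Data.Fin using (Fin; zero; suc)
open import Data.Fin.Subset using (Subset; inside; outside; ⁅_⁆; _∈_; ∣_∣)
open import Data.Fin.Subset.Properties using (_∈?_)
open import Data.Vec using (Vec; []; _∷_; _∷ʳ_; zipWith)
open import Data.List using (List; []; _∷_; _++_; map; filter; allFin; length; lookup)
open import Data.Maybe using (Maybe; just; nothing)
open import Data.Product using (Σ; _,_; ∃; ∃₂; _×_)
open import Data.Sum using (_⊎_)
open import Relation.Binary.PropositionalEquality using (_≡_; refl; _≢_; cong)

-- Finite-set combinatorics.  [n] is modelled by Fin n, 2^[n] by
-- Subset n (= Vec Bool n).  In [n+1] = Fin (suc n) the element n+1 is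
-- the LAST index (Data.Fin.fromℕ n).

_△_ : ∀ {n} → Subset n → Subset n → Subset n
_△_ = zipWith _xor_

_△ₑ_ : ∀ {n} → Subset n → Fin n → Subset n
I △ₑ i = I △ ⁅ i ⁆

odd? : ∀ {n} → Subset n → Bool
odd? [] = false
odd? (b ∷ p) = b xor odd? p

EvenSubset : ℕ → Set
EvenSubset m = Σ (Subset m) (λ A → odd? A ≡ false)

private
  xor-not : ∀ a b → a xor not b ≡ not (a xor b)
  xor-not true true = refl
  xor-not true false = refl
  xor-not false b = refl

  xor-self : ∀ a → a xor a ≡ false
  xor-self true = refl
  xor-self false = refl

  xor-false : ∀ a → a xor false ≡ a
  xor-false true = refl
  xor-false false = refl

  xor-assoc : ∀ a b c → (a xor b) xor c ≡ a xor (b xor c)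
  xor-assoc true true c = not-not c
    where
    not-not : ∀ c → c ≡ not (not c)
    not-not true = refl
    not-not false = refl
  xor-assoc true false c = refl
  xor-assoc false b c = refl

  oddZero : ∀ {m} (J : Subset m) → odd? (zipWith _xor_ J (Data.Fin.Subset.⊥)) ≡ odd? J
  oddZero [] = refl
  oddZero (c ∷ J) rewrite oddZero J | xor-false c = refl

  xor-not-l : ∀ a c → not a xor c ≡ not (a xor c)
  xor-not-l true true = refl
  xor-not-l true false = refl
  xor-not-l false c = refl

  oddFlip : ∀ {n} (I : Subset n) (i : Fin n) → odd? (I △ₑ i) ≡ not (odd? I)
  oddFlip (true ∷ I) zero rewrite oddZero I = xor-not-l true (odd? I)
  oddFlip (false ∷ I) zero rewrite oddZero I = refl
  oddFlip (b ∷ I) (suc i) rewrite xor-false b | oddFlip I i = xor-not b (odd? I)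

  oddSnoc : ∀ {n} (A : Subset n) c → odd? (A ∷ʳ c) ≡ odd? A xor c
  oddSnoc [] c = xor-false c
  oddSnoc (b ∷ A) c rewrite oddSnoc A c = Relation.Binary.PropositionalEquality.sym (xor-assoc b (odd? A) c)

flipOdd : ∀ {n} (I : Subset n) → odd? I ≡ true → (i : Fin n) → odd? (I △ₑ i) ≡ false
flipOdd I p i rewrite oddFlip I i | p = refl

bar : ∀ {n} → Subset n → Subset (suc n)
bar A = A ∷ʳ odd? A

barEven : ∀ {n} (A : Subset n) → odd? (bar A) ≡ false
barEven A rewrite oddSnoc A (odd? A) = xor-self (odd? A)

barE : ∀ {n} → Subset n → EvenSubset (suc n)
barE A = bar A , barEven A

dropLast : ∀ {n} → Subset (suc n) → Subset n
dropLast {zero} (b ∷ []) = []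
dropLast {suc n} (b ∷ p) = b ∷ dropLast p

-- Tropical numbers over an arbitrary totally ordered carrier R
-- (ℝ is not available in agda-stdlib).
-- 𝕋 = R ∪ {∞}, with ∞ = nothing.

module Tropical (R : Set) (_≤_ : R → R → Set) (_+_ : R → R → R) where

  𝕋 : Set
  𝕋 = Maybe R

  ∞ : 𝕋
  ∞ = nothing

  _⊙_ : 𝕋 → 𝕋 → 𝕋
  just a ⊙ just b = just (a + b)
  _ ⊙ _ = nothing

  -- order on 𝕋 with ∞ the top element (min = ⊕)
  _≤𝕋_ : 𝕋 → 𝕋 → Set
  _ ≤𝕋 nothing = Data.Unit.⊤ where import Data.Unit
  nothing ≤𝕋 just _ = Data.Empty.⊥ where import Data.Empty
  just a ≤𝕋 just b = a ≤ b

  -- A tropical polynomial evaluated at a point, given as the list of the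
  -- values of its monomials.
  Satisfied : List 𝕋 → Set
  Satisfied L =
    ((k : Fin (length L)) → lookup L k ≡ ∞)
    ⊎ (∃₂ λ (k l : Fin (length L)) → k ≢ l × lookup L k ≡ lookup L l
                                     × ((m : Fin (length L)) → lookup L k ≤𝕋 lookup L m))

  elems : ∀ {n} → Subset n → List (Fin n)
  elems {n} S = filter (_∈? S) (allFin n)

  fB : ∀ {n} → (Subset n → 𝕋) → Subset n → Subset n → List 𝕋
  fB x I J = lead (odd? (I △ J)) ++ map (λ i → x (I △ₑ i) ⊙ x (J △ₑ i)) (elems (I △ J))
    where
    lead : Bool → List 𝕋
    lead true = x I ⊙ x J ∷ []
    lead false = []

  DrB : (n : ℕ) → (Subset n → 𝕋) → Set
  DrB n x = (I J : Subset n) → 3 Data.Nat.≤ ∣ I △ J ∣ → Satisfied (fB x I J)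

  fD : ∀ {m} → (EvenSubset m → 𝕋) → (I J : Subset m) → odd? I ≡ true → odd? J ≡ true → List 𝕋
  fD y I J pI pJ =
    map (λ i → y (I △ₑ i , flipOdd I pI i) ⊙ y (J △ₑ i , flipOdd J pJ i)) (elems (I △ J))

  DrD : (m : ℕ) → (EvenSubset m → 𝕋) → Set
  DrD m y = (I J : Subset m) (pI : odd? I ≡ true) (pJ : odd? J ≡ true)
            → 4 Data.Nat.≤ ∣ I △ J ∣ → Satisfied (fD y I J pI pJ)

  -- the coordinate relabelling 𝕋^{2^[n]} → 𝕋^{even subsets of [n+1]}
  -- induced by A ↦ Ā :  (Φ x)_{Ā} = x_A
  Φ : ∀ {n} → (Subset n → 𝕋) → (EvenSubset (suc n) → 𝕋)
  Φ x (A' , _) = x (dropLast A')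

  Ψ : ∀ {n} → (EvenSubset (suc n) → 𝕋) → (Subset n → 𝕋)
  Ψ y A = y (barE A)

{-# OPTIONS --safe #-}
-- For odd I, J ⊆ [n+1] let I′ = I ∖ {n+1} and J′ = J ∖ {n+1}; every pair of subsets of [n]
-- arises this way. Under the relabelling the monomial for i ≤ n of f^D_{I,J} becomes the
-- monomial for i of f^B_{I′,J′}, and the one for i = n+1 becomes x_{I′} ⊙ x_{J′}. As |I △ J|
-- is even, n+1 ∈ I △ J exactly when |I′ △ J′| is odd, i.e. exactly when f^B_{I′,J′} has that
-- extra monomial. So the two polynomials have the same monomials up to order, and
-- |I △ J| ≥ 4 iff |I′ △ J′| ≥ 3.
module Submission where

open import Defs
open import Data.Nat using (ℕ; zero; suc; _≤_; z≤n; s≤s; s≤s⁻¹)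
open import Data.Fin.Subset using (Subset)
open import Data.Product using (_×_; _,_; proj₁)
open import Relation.Binary.Structures using (IsTotalOrder)
open import Function.Definitions using (Bijective)
open import Function.Bundles using (_⇔_; mk⇔; Equivalence)

open import Algebra.Bundles using (CommutativeRing)
open import Axiom.UniquenessOfIdentityProofs using (module Decidable⇒UIP)
open import Data.Bool using (Bool; true; false; not; _xor_; if_then_else_)
import Data.Bool.Properties as Bool
open import Data.Fin using (Fin; zero; suc; inject₁; fromℕ)
open import Data.Fin.Permutation using (_⟨$⟩ʳ_; _⟨$⟩ˡ_; inverseˡ; inverseʳ)
open import Data.Fin.Subset using (∣_∣) renaming (⊥ to ∅)
open import Data.Fin.Subset.Properties using (_∈?_)
open import Data.List using (List; []; _∷_; [_]; _++_; map; filter; tabulate; lookup)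
open import Data.List.Properties using (map-∘; map-cong; map-++; ++-assoc)
import Data.List.Relation.Binary.Permutation.Setoid as Permutation
import Data.List.Relation.Binary.Permutation.Setoid.Properties as PermutationProperties
open import Data.Nat.Properties using (<⇒≤)
open import Data.Sum using (inj₁; inj₂)
open import Data.Vec using ([]; _∷_; _∷ʳ_; last)
open import Function using (_∘_; id)
open import Function.Properties.Equivalence using () renaming (sym to ⇔-sym)
open import Function.Consequences.Propositional using (strictlySurjective⇒surjective)
open import Relation.Binary.PropositionalEquality
  using (_≡_; _≗_; refl; sym; trans; cong; cong₂; subst; subst₂; setoid; module ≡-Reasoning)
open import Relation.Nullary using (yes; no)

open import Algebra.Properties.CommutativeSemigroup
  (CommutativeRing.+-commutativeSemigroup Bool.xor-∧-commutativeRing) using (interchange)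

xor≡false⇒≡ : ∀ {a b} → a xor b ≡ false → a ≡ b
xor≡false⇒≡ {true}  {true}  _ = refl
xor≡false⇒≡ {false} {false} _ = refl

odd?-∷ʳ : ∀ {n} (A : Subset n) b → odd? (A ∷ʳ b) ≡ odd? A xor b
odd?-∷ʳ []      b = Bool.xor-identityʳ b
odd?-∷ʳ (a ∷ A) b = trans (cong (a xor_) (odd?-∷ʳ A b)) (sym (Bool.xor-assoc a (odd? A) b))

odd?-△ : ∀ {n} (A B : Subset n) → odd? (A △ B) ≡ odd? A xor odd? B
odd?-△ []      []      = refl
odd?-△ (a ∷ A) (b ∷ B) =
  trans (cong ((a xor b) xor_) (odd?-△ A B)) (interchange a b (odd? A) (odd? B))

△-∅ : ∀ {n} (A : Subset n) → A △ ∅ ≡ A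
△-∅ []      = refl
△-∅ (a ∷ A) = cong₂ _∷_ (Bool.xor-identityʳ a) (△-∅ A)

dropLast-∷ʳ : ∀ {n} (A : Subset n) b → dropLast (A ∷ʳ b) ≡ A
dropLast-∷ʳ []      b = refl
dropLast-∷ʳ (a ∷ A) b = cong (a ∷_) (dropLast-∷ʳ A b)

dropLast-∷ʳ-last : ∀ {n} (T : Subset (suc n)) → dropLast T ∷ʳ last T ≡ T
dropLast-∷ʳ-last {zero}  (b ∷ []) = refl
dropLast-∷ʳ-last {suc n} (b ∷ T)  = cong (b ∷_) (dropLast-∷ʳ-last T)

dropLast-△ : ∀ {n} (I J : Subset (suc n)) → dropLast (I △ J) ≡ dropLast I △ dropLast J
dropLast-△ {zero}  (a ∷ []) (b ∷ []) = refl
dropLast-△ {suc n} (a ∷ I)  (b ∷ J)  = cong ((a xor b) ∷_) (dropLast-△ I J)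

dropLast-△-inject₁ : ∀ {n} (I : Subset (suc n)) (k : Fin n) →
                     dropLast (I △ₑ inject₁ k) ≡ dropLast I △ₑ k
dropLast-△-inject₁ {suc n} (b ∷ I) zero    =
  cong ((b xor true) ∷_) (trans (cong dropLast (△-∅ I)) (sym (△-∅ (dropLast I))))
dropLast-△-inject₁ {suc n} (b ∷ I) (suc k) = cong ((b xor false) ∷_) (dropLast-△-inject₁ I k)

dropLast-△-fromℕ : ∀ {n} (I : Subset (suc n)) → dropLast (I △ₑ fromℕ n) ≡ dropLast I
dropLast-△-fromℕ {zero}  (b ∷ []) = refl
dropLast-△-fromℕ {suc n} (b ∷ I)  = cong₂ _∷_ (Bool.xor-identityʳ b) (dropLast-△-fromℕ I)

odd?-dropLast : ∀ {n} (T : Subset (suc n)) → odd? T ≡ odd? (dropLast T) xor last T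
odd?-dropLast T = trans (cong odd? (sym (dropLast-∷ʳ-last T))) (odd?-∷ʳ (dropLast T) (last T))

even⇒odd?-dropLast≡last : ∀ {n} (T : Subset (suc n)) → odd? T ≡ false → odd? (dropLast T) ≡ last T
even⇒odd?-dropLast≡last T even = xor≡false⇒≡ (trans (sym (odd?-dropLast T)) even)

bar-dropLast : ∀ {n} (T : Subset (suc n)) → odd? T ≡ false → bar (dropLast T) ≡ T
bar-dropLast T even =
  trans (cong (dropLast T ∷ʳ_) (even⇒odd?-dropLast≡last T even)) (dropLast-∷ʳ-last T)

odd?-△-odd : ∀ {n} (I J : Subset n) → odd? I ≡ true → odd? J ≡ true → odd? (I △ J) ≡ false
odd?-△-odd I J pI pJ = trans (odd?-△ I J) (cong₂ _xor_ pI pJ)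

isOdd : ℕ → Bool
isOdd zero    = false
isOdd (suc m) = not (isOdd m)

odd?≡isOdd∣∣ : ∀ {n} (A : Subset n) → odd? A ≡ isOdd ∣ A ∣
odd?≡isOdd∣∣ []          = refl
odd?≡isOdd∣∣ (true ∷ A)  = cong not (odd?≡isOdd∣∣ A)
odd?≡isOdd∣∣ (false ∷ A) = odd?≡isOdd∣∣ A

∣∷ʳ∣≡∣∷∣ : ∀ {n} (A : Subset n) b → ∣ A ∷ʳ b ∣ ≡ ∣ b ∷ A ∣
∣∷ʳ∣≡∣∷∣ []          b     = refl
∣∷ʳ∣≡∣∷∣ (true ∷ A)  true  = cong suc (∣∷ʳ∣≡∣∷∣ A true)
∣∷ʳ∣≡∣∷∣ (true ∷ A)  false = cong suc (∣∷ʳ∣≡∣∷∣ A false)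
∣∷ʳ∣≡∣∷∣ (false ∷ A) b     = ∣∷ʳ∣≡∣∷∣ A b

even∧3≤⇒4≤ : ∀ {m} → isOdd m ≡ false → 3 ≤ m → 4 ≤ m
even∧3≤⇒4≤ {3}                       () (s≤s (s≤s (s≤s z≤n)))
even∧3≤⇒4≤ {suc (suc (suc (suc m)))} _  (s≤s (s≤s (s≤s z≤n))) = s≤s (s≤s (s≤s (s≤s z≤n)))

3≤∣∣⇔4≤∣bar∣ : ∀ {n} (A : Subset n) → 3 ≤ ∣ A ∣ ⇔ 4 ≤ ∣ bar A ∣
3≤∣∣⇔4≤∣bar∣ A rewrite ∣∷ʳ∣≡∣∷∣ A (odd? A) with odd? A | odd?≡isOdd∣∣ A
... | true  | _    = mk⇔ s≤s s≤s⁻¹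
... | false | even = mk⇔ (even∧3≤⇒4≤ (sym even)) <⇒≤

4≤∣∣⇔3≤∣dropLast∣ : ∀ {n} (T : Subset (suc n)) → odd? T ≡ false → 4 ≤ ∣ T ∣ ⇔ 3 ≤ ∣ dropLast T ∣
4≤∣∣⇔3≤∣dropLast∣ T even = subst (λ S → 4 ≤ ∣ S ∣ ⇔ 3 ≤ ∣ dropLast T ∣) (bar-dropLast T even)
  (⇔-sym (3≤∣∣⇔4≤∣bar∣ (dropLast T)))

oddLift : ∀ {n} → Subset n → Subset (suc n)
oddLift A = A ∷ʳ not (odd? A)

odd?-oddLift : ∀ {n} (A : Subset n) → odd? (oddLift A) ≡ true
odd?-oddLift A = trans (odd?-∷ʳ A (not (odd? A))) (Bool.xor-inverseʳ (odd? A))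

EvenSubset-≡ : ∀ {m} {A B : EvenSubset m} → proj₁ A ≡ proj₁ B → A ≡ B
EvenSubset-≡ {A = A , p} {B = .A , q} refl = cong (A ,_) (Decidable⇒UIP.≡-irrelevant Bool._≟_ p q)

barE-dropLast : ∀ {n} (A : EvenSubset (suc n)) → barE (dropLast (proj₁ A)) ≡ A
barE-dropLast (T , even) = EvenSubset-≡ (bar-dropLast T even)

barE-injective : ∀ {n} {A B : Subset n} → barE A ≡ barE B → A ≡ B
barE-injective {A = A} {B} e =
  trans (sym (dropLast-∷ʳ A (odd? A))) (trans (cong (dropLast ∘ proj₁) e) (dropLast-∷ʳ B (odd? B)))

barE-bijective : ∀ {n} → Bijective _≡_ _≡_ (barE {n})
barE-bijective = barE-injective
               , strictlySurjective⇒surjective (λ A → dropLast (proj₁ A) , barE-dropLast A)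

[_]if_ : ∀ {A : Set} → A → Bool → List A
[ a ]if b = if b then [ a ] else []

map-[]if : ∀ {A B : Set} (f : A → B) {a} b → map f ([ a ]if b) ≡ [ f a ]if b
map-[]if f true  = refl
map-[]if f false = refl

filter-∈?-∷-suc : ∀ {n m} b (S : Subset n) (g : Fin m → Fin n) →
                  filter (_∈? (b ∷ S)) (tabulate (suc ∘ g)) ≡ map suc (filter (_∈? S) (tabulate g))
filter-∈?-∷-suc {m = zero}  b S g = refl
filter-∈?-∷-suc {m = suc m} b S g with g zero ∈? S
... | yes _ = cong (suc (g zero) ∷_) (filter-∈?-∷-suc b S (g ∘ suc))
... | no  _ = filter-∈?-∷-suc b S (g ∘ suc)

module Relabelling (R : Set) (_≼_ : R → R → Set) (_+_ : R → R → R) where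
  open Tropical R _≼_ _+_
  open Permutation (setoid 𝕋) using (_↭_; ↭-sym; onIndices; module PermutationReasoning)
  open PermutationProperties (setoid 𝕋) using (onIndices-lookup; ++-comm)

  Satisfied-↭ : ∀ {L L′} → L ↭ L′ → Satisfied L → Satisfied L′
  Satisfied-↭ {L} {L′} L↭L′ = λ where
      (inj₁ all∞) → inj₁ λ j → trans (lookup-from j) (all∞ (π ⟨$⟩ˡ j))
      (inj₂ (k , l , k≢l , k≈l , k-minimal)) →
        inj₂ ( π ⟨$⟩ʳ k , π ⟨$⟩ʳ l , k≢l ∘ to-injective
             , trans (sym (lookup-to k)) (trans k≈l (lookup-to l))
             , λ j → subst₂ _≤𝕋_ (lookup-to k) (sym (lookup-from j)) (k-minimal (π ⟨$⟩ˡ j)) )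
    where
    π = onIndices L↭L′
    lookup-to : ∀ i → lookup L i ≡ lookup L′ (π ⟨$⟩ʳ i)
    lookup-to = onIndices-lookup L↭L′
    lookup-from : ∀ j → lookup L′ j ≡ lookup L (π ⟨$⟩ˡ j)
    lookup-from j = trans (cong (lookup L′) (sym (inverseʳ π))) (sym (lookup-to (π ⟨$⟩ˡ j)))
    to-injective : ∀ {i i′} → π ⟨$⟩ʳ i ≡ π ⟨$⟩ʳ i′ → i ≡ i′
    to-injective e = trans (sym (inverseˡ π)) (trans (cong (π ⟨$⟩ˡ_) e) (inverseˡ π))

  elems-∷ : ∀ {n} b (S : Subset n) → elems (b ∷ S) ≡ [ zero ]if b ++ map suc (elems S)
  elems-∷ true  S = cong (zero ∷_) (filter-∈?-∷-suc true S id)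
  elems-∷ false S = filter-∈?-∷-suc false S id

  map-elems-∷ : ∀ {n} {A : Set} (h : Fin (suc n) → A) b (S : Subset n) →
                map h (elems (b ∷ S)) ≡ [ h zero ]if b ++ map (h ∘ suc) (elems S)
  map-elems-∷ h b S = begin
      map h (elems (b ∷ S))
    ≡⟨ cong (map h) (elems-∷ b S) ⟩
      map h ([ zero ]if b ++ map suc (elems S))
    ≡⟨ map-++ h ([ zero ]if b) _ ⟩
      map h ([ zero ]if b) ++ map h (map suc (elems S))
    ≡⟨ cong₂ _++_ (map-[]if h b) (sym (map-∘ (elems S))) ⟩
      [ h zero ]if b ++ map (h ∘ suc) (elems S)
    ∎
    where open ≡-Reasoning

  map-elems-dropLast : ∀ {n} {A : Set} (h : Fin (suc n) → A) (T : Subset (suc n)) →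
    map h (elems T) ≡ map (h ∘ inject₁) (elems (dropLast T)) ++ [ h (fromℕ n) ]if last T
  map-elems-dropLast {zero}  h (true ∷ [])  = refl
  map-elems-dropLast {zero}  h (false ∷ []) = refl
  map-elems-dropLast {suc n} h (b ∷ T)      = begin
      map h (elems (b ∷ T))
    ≡⟨ map-elems-∷ h b T ⟩
      [ h zero ]if b ++ map (h ∘ suc) (elems T)
    ≡⟨ cong ([ h zero ]if b ++_) (map-elems-dropLast (h ∘ suc) T) ⟩
      [ h zero ]if b ++ (map (h ∘ suc ∘ inject₁) (elems (dropLast T)) ++ [ h (fromℕ (suc n)) ]if last T)
    ≡⟨ ++-assoc ([ h zero ]if b) _ _ ⟨
      ([ h zero ]if b ++ map (h ∘ suc ∘ inject₁) (elems (dropLast T))) ++ [ h (fromℕ (suc n)) ]if last T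
    ≡⟨ cong (_++ [ h (fromℕ (suc n)) ]if last T) (map-elems-∷ (h ∘ inject₁) b (dropLast T)) ⟨
      map (h ∘ inject₁) (elems (b ∷ dropLast T)) ++ [ h (fromℕ (suc n)) ]if last T
    ∎
    where open ≡-Reasoning

  monomial : ∀ {n} → (Subset n → 𝕋) → Subset n → Subset n → Fin n → 𝕋
  monomial x I J i = x (I △ₑ i) ⊙ x (J △ₑ i)

  fB≡ : ∀ {n} (x : Subset n → 𝕋) I J →
        fB x I J ≡ [ x I ⊙ x J ]if odd? (I △ J) ++ map (monomial x I J) (elems (I △ J))
  fB≡ x I J with odd? (I △ J)
  ... | true  = refl
  ... | false = refl

  fD-Φ-↭-fB : ∀ {n} (x : Subset n → 𝕋) (I J : Subset (suc n)) pI pJ →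
              fD (Φ x) I J pI pJ ↭ fB x (dropLast I) (dropLast J)
  fD-Φ-↭-fB {n} x I J pI pJ = begin
      fD (Φ x) I J pI pJ
    ≡⟨ map-elems-dropLast h (I △ J) ⟩
      map (h ∘ inject₁) (elems (dropLast (I △ J))) ++ [ h (fromℕ n) ]if last (I △ J)
    ≡⟨ cong₂ _++_ monomials≡ last-monomial≡ ⟩
      map (monomial x I′ J′) (elems (I′ △ J′)) ++ [ x I′ ⊙ x J′ ]if odd? (I′ △ J′)
    ↭⟨ ++-comm (map (monomial x I′ J′) (elems (I′ △ J′))) ([ x I′ ⊙ x J′ ]if odd? (I′ △ J′)) ⟩
      [ x I′ ⊙ x J′ ]if odd? (I′ △ J′) ++ map (monomial x I′ J′) (elems (I′ △ J′))
    ≡⟨ fB≡ x I′ J′ ⟨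
      fB x I′ J′
    ∎
    where
    open PermutationReasoning
    I′ = dropLast I
    J′ = dropLast J
    h : Fin (suc n) → 𝕋
    h i = x (dropLast (I △ₑ i)) ⊙ x (dropLast (J △ₑ i))
    monomials≡ : map (h ∘ inject₁) (elems (dropLast (I △ J))) ≡ map (monomial x I′ J′) (elems (I′ △ J′))
    monomials≡ = trans
      (map-cong (λ k → cong₂ _⊙_ (cong x (dropLast-△-inject₁ I k)) (cong x (dropLast-△-inject₁ J k))) _)
      (cong (map (monomial x I′ J′) ∘ elems) (dropLast-△ I J))
    last-monomial≡ : [ h (fromℕ n) ]if last (I △ J) ≡ [ x I′ ⊙ x J′ ]if odd? (I′ △ J′)
    last-monomial≡ = cong₂ [_]if_
      (cong₂ _⊙_ (cong x (dropLast-△-fromℕ I)) (cong x (dropLast-△-fromℕ J)))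
      (trans (sym (even⇒odd?-dropLast≡last (I △ J) (odd?-△-odd I J pI pJ))) (cong odd? (dropLast-△ I J)))

  DrB⇒DrD-Φ : ∀ {n} (x : Subset n → 𝕋) → DrB n x → DrD (suc n) (Φ x)
  DrB⇒DrD-Φ x drB I J pI pJ 4≤∣I△J∣ =
    Satisfied-↭ (↭-sym (fD-Φ-↭-fB x I J pI pJ)) (drB (dropLast I) (dropLast J) 3≤∣I′△J′∣)
    where
    3≤∣I′△J′∣ : 3 ≤ ∣ dropLast I △ dropLast J ∣
    3≤∣I′△J′∣ = subst (λ S → 3 ≤ ∣ S ∣) (dropLast-△ I J)
      (Equivalence.to (4≤∣∣⇔3≤∣dropLast∣ (I △ J) (odd?-△-odd I J pI pJ)) 4≤∣I△J∣)

  DrD-Φ⇒DrB : ∀ {n} (x : Subset n → 𝕋) → DrD (suc n) (Φ x) → DrB n x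
  DrD-Φ⇒DrB x drD I₀ J₀ 3≤∣I₀△J₀∣ =
    subst₂ (λ I′ J′ → Satisfied (fB x I′ J′)) (dropLast-∷ʳ I₀ _) (dropLast-∷ʳ J₀ _)
      (Satisfied-↭ (fD-Φ-↭-fB x I J pI pJ) (drD I J pI pJ 4≤∣I△J∣))
    where
    I = oddLift I₀
    J = oddLift J₀
    pI = odd?-oddLift I₀
    pJ = odd?-oddLift J₀
    4≤∣I△J∣ : 4 ≤ ∣ I △ J ∣
    4≤∣I△J∣ = Equivalence.from (4≤∣∣⇔3≤∣dropLast∣ (I △ J) (odd?-△-odd I J pI pJ))
      (subst (λ S → 3 ≤ ∣ S ∣)
             (sym (trans (dropLast-△ I J) (cong₂ _△_ (dropLast-∷ʳ I₀ _) (dropLast-∷ʳ J₀ _))))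
             3≤∣I₀△J₀∣)

  DrD-resp-≗ : ∀ {m} {y y′ : EvenSubset m → 𝕋} → y ≗ y′ → DrD m y → DrD m y′
  DrD-resp-≗ y≗y′ drD I J pI pJ 4≤ =
    subst Satisfied (map-cong (λ i → cong₂ _⊙_ (y≗y′ _) (y≗y′ _)) (elems (I △ J))) (drD I J pI pJ 4≤)

  Ψ-Φ : ∀ {n} (x : Subset n → 𝕋) → Ψ (Φ x) ≗ x
  Ψ-Φ x A = cong x (dropLast-∷ʳ A (odd? A))

  Φ-Ψ : ∀ {n} (y : EvenSubset (suc n) → 𝕋) → Φ (Ψ y) ≗ y
  Φ-Ψ y A = cong y (barE-dropLast A)

proposition4p7 : (R : Set) (_≼_ : R → R → Set) → IsTotalOrder _≡_ _≼_ → (_+_ : R → R → R) →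
    (n : ℕ) → 1 ≤ n →
    let open Tropical R _≼_ _+_ in
    -- A ↦ Ā is a bijection 2^[n] → even subsets of [n+1]
    Bijective _≡_ _≡_ (barE {n})
    -- Φ is the coordinate relabelling induced by it, with inverse Ψ
    × ((x : Subset n → 𝕋) (A : Subset n) → Φ x (barE A) ≡ x A)
    × ((x : Subset n → 𝕋) (A : Subset n) → Ψ (Φ x) A ≡ x A)
    × ((y : EvenSubset (suc n) → 𝕋) (A' : EvenSubset (suc n)) → Φ (Ψ y) A' ≡ y A')
    -- and it restricts to an isomorphism Dr(B_n,P_n) ≅ Dr(D_{n+1},P_{n+1})
    × ((x : Subset n → 𝕋) → DrB n x ⇔ DrD (suc n) (Φ x))
    × ((y : EvenSubset (suc n) → 𝕋) → DrD (suc n) y ⇔ DrB n (Ψ y))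
proposition4p7 R _≼_ _ _+_ n _ =
    barE-bijective
  , Ψ-Φ
  , Ψ-Φ
  , Φ-Ψ
  , (λ x → mk⇔ (DrB⇒DrD-Φ x) (DrD-Φ⇒DrB x))
  , (λ y → mk⇔ (DrD-Φ⇒DrB (Ψ y) ∘ DrD-resp-≗ (sym ∘ Φ-Ψ y))
               (DrD-resp-≗ (Φ-Ψ y) ∘ DrB⇒DrD-Φ (Ψ y)))
  where
  open Tropical R _≼_ _+_
  open Relabelling R _≼_ _+_
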